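{- Let $n \geq 4$ be an even integer and let $\widetilde{L}$ be the special Laplacian of the wheel graph $W_n$. Then all column sums of $\widetilde{L}$ are zero and $\mathrm{rank}(\widetilde{L}) = n-1$.
   Context: For $c=(c_1,\dotsc,c_m)$, $\mathrm{Circ}(c)$ denotes the $m\times m$ circulant matrix whose $(i,j)$ entry is $c_{((j-i) \bmod m)+1}$ (first row $c$, each subsequent row the previous one cyclically shifted one place to the right). Special Laplacian: for $n\ge4$ even and $k\in\{1,\dotsc,\frac n2-1\}$, let $c^k\in\mathbb{R}^{n-1}$ have $c^k_j=1$ if $j=k+1$ or $j=n-k$ and $c^k_j=0$ otherwise, and let $C_k=\mathrm{Circ}(c^k)$ (of order $n-1$). Then \[\widetilde{L} := \frac{n-1}{2} I - \frac12\begin{bmatrix}0 & \mathbf{1}'\\ \mathbf{1} & 0\end{bmatrix} + \sum_{k=1}^{\frac n2 -1} (-1)^k \frac{(n-1)-2k}{2}\begin{bmatrix}0&0\\0&C_k\end{bmatrix},\] an $n\times n$ matrix, where $\mathbf{1}$ is the all-ones vector of length $n-1$. (It is associated with the wheel graph $W_n$ whose hub is labelled $1$ and whose rim cycle vertices are labelled $2,\dotsc,n$ in cyclic order.) -}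

module Defs where

open import Data.Nat as ℕ using (ℕ; zero; suc; _∸_; NonZero)
open import Data.Nat.DivMod using (_mod_)
import Data.Nat.DivMod as ℕDM
open import Data.Fin using (Fin; toℕ) renaming (zero to fzero; suc to fsuc)
open import Data.Integer as ℤ using (ℤ; +_)
open import Data.Rational as ℚ using (ℚ; 0ℚ; 1ℚ; _+_; _*_; -_)
open import Data.List using (List; map; foldr; upTo)
open import Data.Bool using (Bool; if_then_else_; _∨_)
open import Data.Product using (Σ; _×_)
open import Relation.Nullary using (¬_)
open import Relation.Nullary.Decidable using (⌊_⌋)
open import Relation.Binary.PropositionalEquality using (_≡_)
open import Function.Definitions using (Injective)

Matrix : ℕ → Set
Matrix n = Fin n → Fin n → ℚ

sumFin : ∀ {n} → (Fin n → ℚ) → ℚ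
sumFin {zero}  f = 0ℚ
sumFin {suc n} f = f fzero + sumFin (λ i → f (fsuc i))

zeroM : ∀ {n} → Matrix n
zeroM _ _ = 0ℚ

_⊕_ : ∀ {n} → Matrix n → Matrix n → Matrix n
(A ⊕ B) i j = A i j + B i j
infixl 6 _⊕_

_·_ : ∀ {n} → ℚ → Matrix n → Matrix n
(a · A) i j = a * A i j
infixl 7 _·_

idM : ∀ {n} → Matrix n
idM i j = if ⌊ i Data.Fin.≟ j ⌋ then 1ℚ else 0ℚ

-- Circ(c): (i,j) entry (1-based) is c_{((j-i) mod m)+1};
-- 0-based: entry (i,j) is c at index (j - i) mod m, computed as (j + (m - i)) mod m.
circ : (m : ℕ) .{{_ : NonZero m}} → (Fin m → ℚ) → Matrix m
circ m c i j = c ((toℕ j ℕ.+ (m ∸ toℕ i)) mod m)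

-- c^k ∈ ℚ^(n-1) with n = suc m: c^k_j = 1 iff j = k+1 or j = n-k  (1-based j = toℕ t + 1)
cvec : (m k : ℕ) → Fin m → ℚ
cvec m k t =
  if ⌊ suc (toℕ t) ℕ.≟ suc k ⌋ ∨ ⌊ suc (toℕ t) ℕ.≟ (suc m ∸ k) ⌋ then 1ℚ else 0ℚ

lowerRight : ∀ {m} → Matrix m → Matrix (suc m)
lowerRight A fzero    _        = 0ℚ
lowerRight A (fsuc i) fzero    = 0ℚ
lowerRight A (fsuc i) (fsuc j) = A i j

hubM : ∀ {m} → Matrix (suc m)
hubM fzero    fzero    = 0ℚ
hubM fzero    (fsuc _) = 1ℚ
hubM (fsuc _) fzero    = 1ℚ
hubM (fsuc _) (fsuc _) = 0ℚ

negOnePow : ℕ → ℚ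
negOnePow zero    = 1ℚ
negOnePow (suc k) = - negOnePow k

sumM : ∀ {n} → List (Matrix n) → Matrix n
sumM = foldr _⊕_ zeroM

-- The special Laplacian L̃ of W_n (n = suc m, so n - 1 = m).
-- Only meaningful for n ≥ 4; for n ≤ 1 a dummy zero matrix is used.
specialLaplacian : (n : ℕ) → Matrix n
specialLaplacian zero = zeroM
specialLaplacian (suc zero) = zeroM
specialLaplacian (suc (suc m')) =
  ((+ m ℚ./ 2) · idM)
  ⊕ ((- (+ 1 ℚ./ 2)) · hubM)
  ⊕ sumM (map term (map suc (upTo (n ℕDM./ 2 ∸ 1))))
  where
  m = suc m'
  n = suc m
  term : ℕ → Matrix n
  term k = (negOnePow k * ((+ m ℤ.- + (2 ℕ.* k)) ℚ./ 2)) · lowerRight (circ m (cvec m k))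

colSum : ∀ {n} → Matrix n → Fin n → ℚ
colSum M j = sumFin (λ i → M i j)

LinIndepCols : ∀ {n r} → Matrix n → (Fin r → Fin n) → Set
LinIndepCols {n} {r} M s =
  (a : Fin r → ℚ) → (∀ i → sumFin (λ t → a t * M i (s t)) ≡ 0ℚ) → ∀ t → a t ≡ 0ℚ

HasRank : ∀ {n} → Matrix n → ℕ → Set
HasRank {n} M r =
  (Σ (Fin r → Fin n) λ s → Injective _≡_ _≡_ s × LinIndepCols M s)
  × ((s : Fin (suc r) → Fin n) → Injective _≡_ _≡_ s → ¬ LinIndepCols M s)

-- Write n = 2p + 2 and m = n − 1 = 2p + 1. Off the hub row and column, whose
-- entries are m/2 on the diagonal and −½ elsewhere, L̃ is the circulant
-- Circ(w_0, …, w_{m−1}) with w_d = (−1)^d (m − 2d)/2; for d > p this uses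
-- w_{m−d} = w_d, which holds because m is odd. The weights satisfy
-- w_d + 2w_{d+1} + w_{d+2} = 0, and read cyclically modulo m this three-term sum
-- is 2 exactly when d + 1 ≡ 0: in matrix terms (I + P)² C = 2P for the rim block C
-- and the cyclic shift P. Summing shows that every row and column sum of C is ½,
-- so those of L̃ vanish; the all-ones vector is then in the kernel and no n columns
-- are independent. Applying (I + P)² to a vanishing combination Cx = 0 gives
-- 2Px = 0, so the m rim columns are independent and the rank is n − 1.

module Submission where

open import Defs
open import Data.Nat using (ℕ; _≤_; _∸_)
open import Data.Nat.Divisibility using (_∣_)
open import Data.Fin using (Fin)
open import Data.Rational using (0ℚ)
open import Data.Product using (_×_)
open import Relation.Binary.PropositionalEquality using (_≡_)

open import Algebra.Bundles using (CommutativeRing)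
import Algebra.Properties.Semiring.Sum as Sum
open import Data.Empty using (⊥-elim)
open import Data.Fin as F using (toℕ) renaming (zero to fzero; suc to fsuc)
import Data.Fin.Permutation as Perm
import Data.Fin.Properties as FP
open import Data.Integer as ℤ using (+_)
import Data.Integer.Tactic.RingSolver as ℤ-Solver
open import Data.List using (List; []; _∷_; map; foldr; upTo; applyUpTo)
import Data.List.Properties as LP
open import Data.Nat as ℕ using (zero; suc; _<_; _%_; s≤s; z≤n; NonZero)
open import Data.Nat.DivMod using (_mod_; m<n⇒m%n≡m; n%n≡0; m%n%n≡m%n; %-distribˡ-+; [m+n]%n≡m%n; m*n/n≡m)
open import Data.Nat.Divisibility using (divides)
import Data.Nat.Properties as ℕP
import Data.Nat.Tactic.RingSolver as ℕ-Solver
open import Data.Product using (∃; _,_; proj₁; proj₂)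
open import Data.Rational as ℚ using (ℚ; 1ℚ; ½; _+_; _*_; -_; _-_; _/_; toℚᵘ)
import Data.Rational.Properties as ℚP
open import Data.Rational.Solver using (module +-*-Solver)
import Data.Rational.Unnormalised as ℚᵘ
import Data.Rational.Unnormalised.Properties as ℚᵘP
open import Data.Sum using (_⊎_; inj₁; inj₂)
open import Function using (_∘_)
open import Function.Definitions using (Injective)
open import Relation.Nullary using (¬_; Dec; yes; no)
open import Relation.Binary.PropositionalEquality using (refl; sym; trans; cong; cong₂; subst; _≢_; module ≡-Reasoning)

open import Algebra.Properties.Group ℚP.+-0-group using (⁻¹-involutive)
open Sum (CommutativeRing.semiring ℚP.+-*-commutativeRing) using (sum; sum-cong-≗; ∑-distrib-+; sum-permute; sum-replicate-zero)

half-homo-+ : ∀ a b → (a ℤ.+ b) / 2 ≡ a / 2 + b / 2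
half-homo-+ a b = ℚP.toℚᵘ-injective (begin
  toℚᵘ ((a ℤ.+ b) / 2)                 ≈⟨ ℚP.toℚᵘ-fromℚᵘ (ℚᵘ.mkℚᵘ (a ℤ.+ b) 1) ⟩
  ℚᵘ.mkℚᵘ (a ℤ.+ b) 1                  ≈⟨ ℚᵘ.*≡* (lemma a b) ⟩
  ℚᵘ.mkℚᵘ a 1 ℚᵘ.+ ℚᵘ.mkℚᵘ b 1         ≈⟨ ℚᵘP.+-cong (ℚP.toℚᵘ-fromℚᵘ (ℚᵘ.mkℚᵘ a 1)) (ℚP.toℚᵘ-fromℚᵘ (ℚᵘ.mkℚᵘ b 1)) ⟨
  toℚᵘ (a / 2) ℚᵘ.+ toℚᵘ (b / 2)       ≈⟨ ℚP.toℚᵘ-homo-+ (a / 2) (b / 2) ⟨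
  toℚᵘ (a / 2 + b / 2)                 ∎)
  where
  open ℚᵘP.≃-Reasoning
  lemma : ∀ a b → (a ℤ.+ b) ℤ.* (+ 2 ℤ.* + 2) ≡ (a ℤ.* + 2 ℤ.+ b ℤ.* + 2) ℤ.* + 2
  lemma = ℤ-Solver.solve-∀

half-homo-neg : ∀ a → (ℤ.- a) / 2 ≡ - (a / 2)
half-homo-neg a = ℚP.toℚᵘ-injective (begin
  toℚᵘ ((ℤ.- a) / 2)        ≈⟨ ℚP.toℚᵘ-fromℚᵘ (ℚᵘ.mkℚᵘ (ℤ.- a) 1) ⟩
  ℚᵘ.- ℚᵘ.mkℚᵘ a 1          ≈⟨ ℚᵘP.-‿cong (ℚP.toℚᵘ-fromℚᵘ (ℚᵘ.mkℚᵘ a 1)) ⟨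
  ℚᵘ.- toℚᵘ (a / 2)         ≈⟨ ℚP.toℚᵘ-homo‿- (a / 2) ⟨
  toℚᵘ (- (a / 2))          ∎)
  where open ℚᵘP.≃-Reasoning

smooth121 : ℚ → ℚ → ℚ → ℚ
smooth121 a b c = a + (b + b) + c

smooth121-comm : ∀ a b c → smooth121 a b c ≡ smooth121 c b a
smooth121-comm = solve 3 (λ a b c → a :+ (b :+ b) :+ c := c :+ (b :+ b) :+ a) refl
  where open +-*-Solver

*-distribˡ-smooth121 : ∀ x a b c → x * smooth121 a b c ≡ smooth121 (x * a) (x * b) (x * c)
*-distribˡ-smooth121 = solve 4 (λ x a b c → x :* (a :+ (b :+ b) :+ c) := x :* a :+ (x :* b :+ x :* b) :+ x :* c) refl
  where open +-*-Solver

smooth121-const : ∀ {c} → smooth121 c c c ≡ 1ℚ + 1ℚ → c ≡ ½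
smooth121-const {c} e = trans (lemma c) (cong (½ * ½ *_) e)
  where
  open +-*-Solver
  lemma : ∀ c → c ≡ ½ * ½ * smooth121 c c c
  lemma = solve 1 (λ c → c := con ½ :* con ½ :* (c :+ (c :+ c) :+ c)) refl

double≡0⇒≡0 : ∀ {c} → c + c ≡ 0ℚ → c ≡ 0ℚ
double≡0⇒≡0 {c} e = trans (lemma c) (cong (½ *_) e)
  where
  open +-*-Solver
  lemma : ∀ c → c ≡ ½ * (c + c)
  lemma = solve 1 (λ c → c := con ½ :* (c :+ c)) refl

sumFin≡sum : ∀ {n} (f : Fin n → ℚ) → sumFin f ≡ sum f
sumFin≡sum {zero}  f = refl
sumFin≡sum {suc n} f = cong (_+_ (f fzero)) (sumFin≡sum (f ∘ fsuc))

sum-smooth121 : ∀ {n} (x y z : Fin n → ℚ) →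
                sum (λ i → smooth121 (x i) (y i) (z i)) ≡ smooth121 (sum x) (sum y) (sum z)
sum-smooth121 x y z = begin
  sum (λ i → x i + (y i + y i) + z i)      ≡⟨ ∑-distrib-+ (λ i → x i + (y i + y i)) z ⟩
  sum (λ i → x i + (y i + y i)) + sum z    ≡⟨ cong (_+ sum z) (∑-distrib-+ x (λ i → y i + y i)) ⟩
  sum x + sum (λ i → y i + y i) + sum z    ≡⟨ cong (λ s → sum x + s + sum z) (∑-distrib-+ y y) ⟩
  sum x + (sum y + sum y) + sum z          ∎
  where open ≡-Reasoning

idM-diag : ∀ {n} (i : Fin n) → idM i i ≡ 1ℚ
idM-diag i with i FP.≟ i
... | yes _ = refl
... | no i≢i = ⊥-elim (i≢i refl)

idM-off : ∀ {n} {i j : Fin n} → i ≢ j → idM i j ≡ 0ℚ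
idM-off {i = i} {j} i≢j with i FP.≟ j
... | yes i≡j = ⊥-elim (i≢j i≡j)
... | no _ = refl

idM-suc : ∀ {n} (i j : Fin n) → idM (fsuc i) (fsuc j) ≡ idM i j
idM-suc i j with i FP.≟ j
... | yes _ = refl
... | no _ = refl

idM-sym : ∀ {n} (i j : Fin n) → idM i j ≡ idM j i
idM-sym i j with i FP.≟ j
... | yes refl = sym (idM-diag i)
... | no i≢j = sym (idM-off (i≢j ∘ sym))

sum-*-idM : ∀ {n} (a : Fin n → ℚ) (j : Fin n) → sum (λ t → a t * idM j t) ≡ a j
sum-*-idM {suc n} a fzero = begin
  a fzero * 1ℚ + sum (λ t → a (fsuc t) * 0ℚ)
    ≡⟨ cong₂ _+_ (ℚP.*-identityʳ (a fzero)) (trans (sum-cong-≗ (ℚP.*-zeroʳ ∘ a ∘ fsuc)) (sum-replicate-zero n)) ⟩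
  a fzero + 0ℚ                                ≡⟨ ℚP.+-identityʳ (a fzero) ⟩
  a fzero                                     ∎
  where open ≡-Reasoning
sum-*-idM {suc n} a (fsuc j) = begin
  a fzero * 0ℚ + sum (λ t → a (fsuc t) * idM (fsuc j) (fsuc t))
    ≡⟨ cong₂ _+_ (ℚP.*-zeroʳ (a fzero)) (sum-cong-≗ (λ t → cong (a (fsuc t) *_) (idM-suc j t))) ⟩
  0ℚ + sum (λ t → a (fsuc t) * idM j t)                          ≡⟨ ℚP.+-identityˡ _ ⟩
  sum (λ t → a (fsuc t) * idM j t)                               ≡⟨ sum-*-idM (a ∘ fsuc) j ⟩
  a (fsuc j)                                                     ∎
  where open ≡-Reasoning

sum-idMʳ : ∀ {n} (i : Fin n) → sum (idM i) ≡ 1ℚ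
sum-idMʳ i = trans (sum-cong-≗ (sym ∘ ℚP.*-identityˡ ∘ idM i)) (sum-*-idM (λ _ → 1ℚ) i)

sum-idMˡ : ∀ {n} (j : Fin n) → sum (λ i → idM i j) ≡ 1ℚ
sum-idMˡ j = trans (sum-cong-≗ (λ i → idM-sym i j)) (sum-idMʳ j)

sum-*-twice-idM : ∀ {n} (x : Fin n → ℚ) (j : Fin n) → sum (λ t → x t * (idM j t + idM j t)) ≡ x j + x j
sum-*-twice-idM x j = begin
  sum (λ t → x t * (idM j t + idM j t))      ≡⟨ sum-cong-≗ (λ t → ℚP.*-distribˡ-+ (x t) (idM j t) (idM j t)) ⟩
  sum (λ t → x t * idM j t + x t * idM j t)  ≡⟨ ∑-distrib-+ (λ t → x t * idM j t) (λ t → x t * idM j t) ⟩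
  sum (λ t → x t * idM j t) + sum (λ t → x t * idM j t)  ≡⟨ cong (λ s → s + s) (sum-*-idM x j) ⟩
  x j + x j                                  ∎
  where open ≡-Reasoning

sum-*-smooth121 : ∀ {n} (x y z w : Fin n → ℚ) →
                  sum (λ t → x t * smooth121 (y t) (z t) (w t)) ≡
                  smooth121 (sum (λ t → x t * y t)) (sum (λ t → x t * z t)) (sum (λ t → x t * w t))
sum-*-smooth121 x y z w =
  trans (sum-cong-≗ (λ t → *-distribˡ-smooth121 (x t) (y t) (z t) (w t)))
        (sum-smooth121 (λ t → x t * y t) (λ t → x t * z t) (λ t → x t * w t))

injective⇒surjective : ∀ {n} {σ : Fin n → Fin n} → Injective _≡_ _≡_ σ → ∀ y → ∃ λ x → σ x ≡ y
injective⇒surjective {suc n} {σ} σ-inj y with FP.any? (λ x → σ x FP.≟ y)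
... | yes hit = hit
... | no miss = ⊥-elim (ℕP.1+n≰n (FP.injective⇒≤ punched-injective))
  where
  σ≢y : ∀ x → σ x ≢ y
  σ≢y x e = miss (x , e)
  punched : Fin (suc n) → Fin n
  punched x = F.punchOut (σ≢y x ∘ sym)
  punched-injective : Injective _≡_ _≡_ punched
  punched-injective e = σ-inj (FP.punchOut-injective (σ≢y _ ∘ sym) (σ≢y _ ∘ sym) e)

sum-reindex : ∀ {n} {σ : Fin n → Fin n} → Injective _≡_ _≡_ σ → (f : Fin n → ℚ) → sum (f ∘ σ) ≡ sum f
sum-reindex {n} {σ} σ-inj f = sym (sum-permute f (Perm.permutation σ σ⁻¹ σ∘σ⁻¹ σ⁻¹∘σ))
  where
  σ⁻¹ : Fin n → Fin n
  σ⁻¹ y = proj₁ (injective⇒surjective σ-inj y)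
  σ∘σ⁻¹ : ∀ y → σ (σ⁻¹ y) ≡ y
  σ∘σ⁻¹ y = proj₂ (injective⇒surjective σ-inj y)
  σ⁻¹∘σ : ∀ x → σ⁻¹ (σ x) ≡ x
  σ⁻¹∘σ x = σ-inj (σ∘σ⁻¹ (σ x))

sum-neg-½ : ∀ q → sum {q} (λ _ → - ½) ≡ - (+ q / 2)
sum-neg-½ zero    = refl
sum-neg-½ (suc q) = begin
  - ½ + sum {q} (λ _ → - ½)   ≡⟨ cong (λ x → - ½ + x) (sum-neg-½ q) ⟩
  - ½ + - (+ q / 2)           ≡⟨ ℚP.neg-distrib-+ ½ (+ q / 2) ⟨
  - (½ + + q / 2)             ≡⟨ cong -_ (half-homo-+ (+ 1) (+ q)) ⟨
  - (+ suc q / 2)             ∎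
  where open ≡-Reasoning

zero-row-sums⇒¬LinIndepCols : ∀ {n} (M : Matrix (suc n)) → (∀ i → sum (M i) ≡ 0ℚ) →
                               (s : Fin (suc n) → Fin (suc n)) → Injective _≡_ _≡_ s → ¬ LinIndepCols M s
zero-row-sums⇒¬LinIndepCols M rows≡0 s s-inj indep = ℚP.1≢0 (indep (λ _ → 1ℚ) ones-in-kernel fzero)
  where
  ones-in-kernel : ∀ i → sumFin (λ t → 1ℚ * M i (s t)) ≡ 0ℚ
  ones-in-kernel i = begin
    sumFin (λ t → 1ℚ * M i (s t))    ≡⟨ sumFin≡sum (λ t → 1ℚ * M i (s t)) ⟩
    sum (λ t → 1ℚ * M i (s t))       ≡⟨ sum-cong-≗ (λ t → ℚP.*-identityˡ (M i (s t))) ⟩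
    sum (M i ∘ s)                    ≡⟨ sum-reindex s-inj (M i) ⟩
    sum (M i)                        ≡⟨ rows≡0 i ⟩
    0ℚ                               ∎
    where open ≡-Reasoning

listSum : List ℚ → ℚ
listSum = foldr _+_ 0ℚ

sumM-entry : ∀ {n} (Ms : List (Matrix n)) i j → sumM Ms i j ≡ listSum (map (λ M → M i j) Ms)
sumM-entry []       i j = refl
sumM-entry (M ∷ Ms) i j = cong (_+_ (M i j)) (sumM-entry Ms i j)

listSum-applyUpTo-zero : ∀ q (h : ℕ → ℚ) → (∀ j → j < q → h j ≡ 0ℚ) → listSum (applyUpTo h q) ≡ 0ℚ
listSum-applyUpTo-zero zero    h h≡0 = refl
listSum-applyUpTo-zero (suc q) h h≡0 =
  cong₂ _+_ (h≡0 0 ℕ.z<s) (listSum-applyUpTo-zero q (h ∘ suc) (λ j j<q → h≡0 (suc j) (s≤s j<q)))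

listSum-applyUpTo-single : ∀ {q} (h : ℕ → ℚ) {j₀} → j₀ < q → (∀ j → j < q → j ≢ j₀ → h j ≡ 0ℚ) →
                           listSum (applyUpTo h q) ≡ h j₀
listSum-applyUpTo-single {suc q} h {zero} _ h≡0 =
  trans (cong (_+_ (h 0)) (listSum-applyUpTo-zero q (h ∘ suc) (λ j j<q → h≡0 (suc j) (s≤s j<q) λ ())))
        (ℚP.+-identityʳ (h 0))
listSum-applyUpTo-single {suc q} h {suc j₀} (s≤s j₀<q) h≡0 =
  trans (cong₂ _+_ (h≡0 0 ℕ.z<s λ ())
                   (listSum-applyUpTo-single (h ∘ suc) j₀<q (λ j j<q j≢j₀ → h≡0 (suc j) (s≤s j<q) (j≢j₀ ∘ ℕP.suc-injective))))
        (ℚP.+-identityˡ (h (suc j₀)))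

-- The weights of the circulant summands

negOnePow-even : ∀ p → negOnePow (p ℕ.+ p) ≡ 1ℚ
negOnePow-even zero = refl
negOnePow-even (suc p) rewrite ℕP.+-suc p p = trans (⁻¹-involutive _) (negOnePow-even p)

negOnePow-∸ : ∀ {m k} → k ≤ m → negOnePow (m ∸ k) ≡ negOnePow m * negOnePow k
negOnePow-∸ {m} z≤n = sym (ℚP.*-identityʳ (negOnePow m))
negOnePow-∸ (s≤s {k} {m} k≤m) = trans (negOnePow-∸ k≤m) (neg*neg (negOnePow m) (negOnePow k))
  where
  open +-*-Solver
  neg*neg : ∀ x y → x * y ≡ (- x) * (- y)
  neg*neg = solve 2 (λ x y → x :* y := (:- x) :* (:- y)) refl

weight : ℕ → ℕ → ℚ
weight m k = negOnePow k * ((+ m ℤ.- + (2 ℕ.* k)) / 2)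

weight-via-halves : ∀ m k → weight m k ≡ negOnePow k * (+ m / 2 - (+ k / 2 + + k / 2))
weight-via-halves m k = cong (negOnePow k *_) (begin
  (+ m ℤ.+ ℤ.- + (2 ℕ.* k)) / 2      ≡⟨ half-homo-+ (+ m) (ℤ.- + (2 ℕ.* k)) ⟩
  + m / 2 + (ℤ.- + (2 ℕ.* k)) / 2    ≡⟨ cong (λ x → + m / 2 + x) (half-homo-neg (+ (2 ℕ.* k))) ⟩
  + m / 2 - + (2 ℕ.* k) / 2          ≡⟨ cong (λ j → + m / 2 - + (k ℕ.+ j) / 2) (ℕP.+-identityʳ k) ⟩
  + m / 2 - + (k ℕ.+ k) / 2          ≡⟨ cong (λ x → + m / 2 - x) (half-homo-+ (+ k) (+ k)) ⟩
  + m / 2 - (+ k / 2 + + k / 2)      ∎)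
  where open ≡-Reasoning

weight-zero : ∀ m → weight m 0 ≡ + m / 2
weight-zero m = trans (weight-via-halves m 0) (lemma (+ m / 2))
  where
  open +-*-Solver
  lemma : ∀ x → 1ℚ * (x - (0ℚ + 0ℚ)) ≡ x
  lemma = solve 1 (λ x → con 1ℚ :* (x :- (con 0ℚ :+ con 0ℚ)) := x) refl

weight-suc : ∀ m k → weight m (suc k) ≡ negOnePow k - weight m k
weight-suc m k = begin
  weight m (suc k)                                       ≡⟨ weight-via-halves m (suc k) ⟩
  (- s) * (M - (h (suc k) + h (suc k)))                  ≡⟨ cong (λ x → (- s) * (M - x)) double-h ⟩
  (- s) * (M - (1ℚ + (h k + h k)))                       ≡⟨ lemma s M (h k + h k) ⟩
  s - s * (M - (h k + h k))                              ≡⟨ cong (_-_ s) (weight-via-halves m k) ⟨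
  s - weight m k                                         ∎
  where
  open ≡-Reasoning
  s = negOnePow k
  M = + m / 2
  h : ℕ → ℚ
  h j = + j / 2
  open +-*-Solver
  double-h : h (suc k) + h (suc k) ≡ 1ℚ + (h k + h k)
  double-h = trans (cong (λ x → x + x) (half-homo-+ (+ 1) (+ k)))
                   (solve 1 (λ K → (con ½ :+ K) :+ (con ½ :+ K) := con 1ℚ :+ (K :+ K)) refl (h k))
  lemma : ∀ s M D → (- s) * (M - (1ℚ + D)) ≡ s - s * (M - D)
  lemma = solve 3 (λ s M D → (:- s) :* (M :- (con 1ℚ :+ D)) := s :- s :* (M :- D)) refl

weight-recurrence : ∀ m r → smooth121 (weight m r) (weight m (suc r)) (weight m (suc (suc r))) ≡ 0ℚ
weight-recurrence m r = begin
  smooth121 (w r) (w (suc r)) (w (suc (suc r)))            ≡⟨ cong (smooth121 (w r) (w (suc r))) (weight-suc m (suc r)) ⟩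
  smooth121 (w r) (w (suc r)) (- s - w (suc r))            ≡⟨ cong (λ x → smooth121 (w r) x (- s - x)) (weight-suc m r) ⟩
  smooth121 (w r) (s - w r) (- s - (s - w r))              ≡⟨ lemma s (w r) ⟩
  0ℚ                                                       ∎
  where
  open ≡-Reasoning
  w = weight m
  s = negOnePow r
  open +-*-Solver
  lemma : ∀ s x → smooth121 x (s - x) (- s - (s - x)) ≡ 0ℚ
  lemma = solve 2 (λ s x → x :+ ((s :- x) :+ (s :- x)) :+ ((:- s) :- (s :- x)) := con 0ℚ) refl

weight-wrap : ∀ m → smooth121 (weight m 1) (weight m 0) (weight m 1) ≡ 1ℚ + 1ℚ
weight-wrap m = trans (cong (λ x → smooth121 x (weight m 0) x) (weight-suc m 0)) (lemma (weight m 0))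
  where
  open +-*-Solver
  lemma : ∀ x → smooth121 (1ℚ - x) x (1ℚ - x) ≡ 1ℚ + 1ℚ
  lemma = solve 1 (λ x → (con 1ℚ :- x) :+ (x :+ x) :+ (con 1ℚ :- x) := con 1ℚ :+ con 1ℚ) refl

weight-sym : ∀ p {k} → let m = suc (p ℕ.+ p) in k ≤ m → weight m (m ∸ k) ≡ weight m k
weight-sym p {k} k≤m = begin
  weight m (m ∸ k)                                      ≡⟨ weight-via-halves m (m ∸ k) ⟩
  negOnePow (m ∸ k) * (+ m / 2 - (h (m ∸ k) + h (m ∸ k)))
    ≡⟨ cong₂ (λ s M → s * (M - (h (m ∸ k) + h (m ∸ k)))) sign halves ⟩
  (- negOnePow k) * ((h (m ∸ k) + h k) - (h (m ∸ k) + h (m ∸ k)))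
    ≡⟨ lemma (negOnePow k) (h (m ∸ k)) (h k) ⟩
  negOnePow k * ((h (m ∸ k) + h k) - (h k + h k))
    ≡⟨ cong (λ M → negOnePow k * (M - (h k + h k))) halves ⟨
  negOnePow k * (+ m / 2 - (h k + h k))                 ≡⟨ weight-via-halves m k ⟨
  weight m k                                            ∎
  where
  open ≡-Reasoning
  m = suc (p ℕ.+ p)
  h : ℕ → ℚ
  h j = + j / 2
  sign : negOnePow (m ∸ k) ≡ - negOnePow k
  sign = trans (negOnePow-∸ k≤m)
    (trans (cong (λ s → (- s) * negOnePow k) (negOnePow-even p))
      (trans (sym (ℚP.neg-distribˡ-* 1ℚ (negOnePow k))) (cong -_ (ℚP.*-identityˡ (negOnePow k)))))
  halves : + m / 2 ≡ h (m ∸ k) + h k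
  halves = trans (cong (λ j → + j / 2) (sym (ℕP.m∸n+n≡m k≤m))) (half-homo-+ (+ (m ∸ k)) (+ k))
  open +-*-Solver
  lemma : ∀ s a b → (- s) * ((a + b) - (a + a)) ≡ s * ((a + b) - (b + b))
  lemma = solve 3 (λ s a b → (:- s) :* ((a :+ b) :- (a :+ a)) := s :* ((a :+ b) :- (b :+ b))) refl

weight-complement : ∀ p {j k} → let m = suc (p ℕ.+ p) in j ℕ.+ k ≡ m → weight m k ≡ weight m j
weight-complement p {j} {k} j+k≡m = trans (cong (weight m) k≡m∸j) (weight-sym p (subst (j ≤_) j+k≡m (ℕP.m≤m+n j k)))
  where
  m = suc (p ℕ.+ p)
  k≡m∸j : k ≡ m ∸ j
  k≡m∸j = trans (sym (ℕP.m+n∸m≡n j k)) (cong (_∸ j) j+k≡m)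

-- Circulant matrices

%-absorbˡ : ∀ a b d .{{_ : NonZero d}} → (a % d ℕ.+ b) % d ≡ (a ℕ.+ b) % d
%-absorbˡ a b d = begin
  (a % d ℕ.+ b) % d            ≡⟨ %-distribˡ-+ (a % d) b d ⟩
  (a % d % d ℕ.+ b % d) % d    ≡⟨ cong (λ x → (x ℕ.+ b % d) % d) (m%n%n≡m%n a d) ⟩
  (a % d ℕ.+ b % d) % d        ≡⟨ %-distribˡ-+ a b d ⟨
  (a ℕ.+ b) % d                ∎
  where open ≡-Reasoning

%-absorbʳ : ∀ a b d .{{_ : NonZero d}} → (a ℕ.+ b % d) % d ≡ (a ℕ.+ b) % d
%-absorbʳ a b d = begin
  (a ℕ.+ b % d) % d   ≡⟨ cong (_% d) (ℕP.+-comm a (b % d)) ⟩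
  (b % d ℕ.+ a) % d   ≡⟨ %-absorbˡ b a d ⟩
  (b ℕ.+ a) % d       ≡⟨ cong (_% d) (ℕP.+-comm b a) ⟩
  (a ℕ.+ b) % d       ∎
  where open ≡-Reasoning

module Circulant (k : ℕ) where

  m : ℕ
  m = suc k

  rot : Fin m → Fin m
  rot i = suc (toℕ i) mod m

  offset : Fin m → Fin m → Fin m
  offset i t = (toℕ t ℕ.+ (m ∸ toℕ i)) mod m

  toℕ-mod : ∀ x → toℕ (x mod m) ≡ x % m
  toℕ-mod x = FP.toℕ-fromℕ< _

  mod-cong : ∀ x y → x % m ≡ y % m → x mod m ≡ y mod m
  mod-cong x y e = FP.toℕ-injective (trans (toℕ-mod x) (trans e (sym (toℕ-mod y))))

  toℕ-rot : ∀ i → toℕ (rot i) ≡ suc (toℕ i) % m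
  toℕ-rot i = toℕ-mod (suc (toℕ i))

  toℕ-offset : ∀ i t → toℕ (offset i t) ≡ (toℕ t ℕ.+ (m ∸ toℕ i)) % m
  toℕ-offset i t = toℕ-mod (toℕ t ℕ.+ (m ∸ toℕ i))

  toℕ-rot-< : ∀ i → suc (toℕ i) < m → toℕ (rot i) ≡ suc (toℕ i)
  toℕ-rot-< i 1+i<m = trans (toℕ-rot i) (m<n⇒m%n≡m 1+i<m)

  toℕ-rot-≡ : ∀ i → suc (toℕ i) ≡ m → toℕ (rot i) ≡ 0
  toℕ-rot-≡ i 1+i≡m = trans (toℕ-rot i) (trans (cong (_% m) 1+i≡m) (n%n≡0 m))

  toℕ<m⇒%≡ : ∀ (i : Fin m) → toℕ i % m ≡ toℕ i
  toℕ<m⇒%≡ i = m<n⇒m%n≡m (FP.toℕ<n i)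

  rot-injective : Injective _≡_ _≡_ rot
  rot-injective {i} {j} e = FP.toℕ-injective (begin
    toℕ i                           ≡⟨ back i ⟨
    (toℕ (rot i) ℕ.+ k) % m         ≡⟨ cong (λ x → (toℕ x ℕ.+ k) % m) e ⟩
    (toℕ (rot j) ℕ.+ k) % m         ≡⟨ back j ⟩
    toℕ j                           ∎)
    where
    open ≡-Reasoning
    back : ∀ i → (toℕ (rot i) ℕ.+ k) % m ≡ toℕ i
    back i = begin
      (toℕ (rot i) ℕ.+ k) % m        ≡⟨ cong (λ x → (x ℕ.+ k) % m) (toℕ-rot i) ⟩
      (suc (toℕ i) % m ℕ.+ k) % m    ≡⟨ %-absorbˡ (suc (toℕ i)) k m ⟩
      (suc (toℕ i) ℕ.+ k) % m        ≡⟨ cong (_% m) (ℕP.+-suc (toℕ i) k) ⟨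
      (toℕ i ℕ.+ m) % m              ≡⟨ [m+n]%n≡m%n (toℕ i) m ⟩
      toℕ i % m                      ≡⟨ toℕ<m⇒%≡ i ⟩
      toℕ i                          ∎

  rot-surjective : ∀ j → ∃ λ i → rot i ≡ j
  rot-surjective = injective⇒surjective rot-injective

  sum-rot : (f : Fin m → ℚ) → sum (f ∘ rot) ≡ sum f
  sum-rot = sum-reindex rot-injective

  offset-rotʳ : ∀ i t → offset i (rot t) ≡ rot (offset i t)
  offset-rotʳ i t = mod-cong (toℕ (rot t) ℕ.+ d) (suc (toℕ (offset i t))) (begin
    (toℕ (rot t) ℕ.+ d) % m            ≡⟨ cong (λ x → (x ℕ.+ d) % m) (toℕ-rot t) ⟩
    (suc (toℕ t) % m ℕ.+ d) % m        ≡⟨ %-absorbˡ (suc (toℕ t)) d m ⟩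
    suc (toℕ t ℕ.+ d) % m              ≡⟨ %-absorbʳ 1 (toℕ t ℕ.+ d) m ⟨
    suc ((toℕ t ℕ.+ d) % m) % m        ≡⟨ cong (λ x → suc x % m) (toℕ-offset i t) ⟨
    suc (toℕ (offset i t)) % m         ∎)
    where
    open ≡-Reasoning
    d = m ∸ toℕ i

  offset-rotˡ : ∀ i t → offset i t ≡ rot (offset (rot i) t)
  offset-rotˡ i t = mod-cong (toℕ t ℕ.+ (m ∸ toℕ i)) (suc (toℕ (offset (rot i) t))) (begin
    (toℕ t ℕ.+ (m ∸ toℕ i)) % m                 ≡⟨ wrap (ℕP.m≤n⇒m<n∨m≡n (FP.toℕ<n i)) ⟩
    suc (toℕ t ℕ.+ (m ∸ toℕ (rot i))) % m       ≡⟨ %-absorbʳ 1 (toℕ t ℕ.+ (m ∸ toℕ (rot i))) m ⟨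
    suc ((toℕ t ℕ.+ (m ∸ toℕ (rot i))) % m) % m ≡⟨ cong (λ x → suc x % m) (toℕ-offset (rot i) t) ⟨
    suc (toℕ (offset (rot i) t)) % m            ∎)
    where
    open ≡-Reasoning
    wrap : suc (toℕ i) < m ⊎ suc (toℕ i) ≡ m →
           (toℕ t ℕ.+ (m ∸ toℕ i)) % m ≡ suc (toℕ t ℕ.+ (m ∸ toℕ (rot i))) % m
    wrap (inj₁ 1+i<m) = cong (_% m) (begin
      toℕ t ℕ.+ (m ∸ toℕ i)                ≡⟨ cong (toℕ t ℕ.+_) (ℕP.+-∸-assoc 1 (ℕP.<⇒≤ 1+i<m)) ⟩
      toℕ t ℕ.+ suc (m ∸ suc (toℕ i))      ≡⟨ ℕP.+-suc (toℕ t) _ ⟩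
      suc (toℕ t ℕ.+ (m ∸ suc (toℕ i)))    ≡⟨ cong (λ j → suc (toℕ t ℕ.+ (m ∸ j))) rot-i ⟨
      suc (toℕ t ℕ.+ (m ∸ toℕ (rot i)))    ∎)
      where
      rot-i = toℕ-rot-< i 1+i<m
    wrap (inj₂ 1+i≡m) = begin
      (toℕ t ℕ.+ (m ∸ toℕ i)) % m             ≡⟨ cong (λ j → (toℕ t ℕ.+ (m ∸ j)) % m) (ℕP.suc-injective 1+i≡m) ⟩
      (toℕ t ℕ.+ (m ∸ k)) % m                 ≡⟨ cong (λ j → (toℕ t ℕ.+ j) % m) (ℕP.m+n∸n≡m 1 k) ⟩
      (toℕ t ℕ.+ 1) % m                       ≡⟨ cong (_% m) (ℕP.+-comm (toℕ t) 1) ⟩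
      suc (toℕ t) % m                         ≡⟨ [m+n]%n≡m%n (suc (toℕ t)) m ⟨
      suc (toℕ t ℕ.+ m) % m                   ≡⟨ cong (λ j → suc (toℕ t ℕ.+ (m ∸ j)) % m) rot-i ⟨
      suc (toℕ t ℕ.+ (m ∸ toℕ (rot i))) % m   ∎
      where
      rot-i = toℕ-rot-≡ i 1+i≡m

  offset-diag : ∀ t → offset t t ≡ fzero
  offset-diag t = mod-cong (toℕ t ℕ.+ (m ∸ toℕ t)) 0 (trans (cong (_% m) (ℕP.m+[n∸m]≡n (ℕP.<⇒≤ (FP.toℕ<n t)))) (n%n≡0 m))

  offset-spec : ∀ i t → (toℕ i ℕ.+ toℕ (offset i t)) % m ≡ toℕ t
  offset-spec i t = begin
    (toℕ i ℕ.+ toℕ (offset i t)) % m            ≡⟨ cong (λ x → (toℕ i ℕ.+ x) % m) (toℕ-offset i t) ⟩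
    (toℕ i ℕ.+ (toℕ t ℕ.+ (m ∸ toℕ i)) % m) % m ≡⟨ %-absorbʳ (toℕ i) _ m ⟩
    (toℕ i ℕ.+ (toℕ t ℕ.+ (m ∸ toℕ i))) % m     ≡⟨ cong (_% m) (ℕP.+-comm (toℕ i) _) ⟩
    (toℕ t ℕ.+ (m ∸ toℕ i) ℕ.+ toℕ i) % m       ≡⟨ cong (_% m) (ℕP.+-assoc (toℕ t) _ _) ⟩
    (toℕ t ℕ.+ ((m ∸ toℕ i) ℕ.+ toℕ i)) % m     ≡⟨ cong (λ x → (toℕ t ℕ.+ x) % m) (ℕP.m∸n+n≡m (ℕP.<⇒≤ (FP.toℕ<n i))) ⟩
    (toℕ t ℕ.+ m) % m                           ≡⟨ [m+n]%n≡m%n (toℕ t) m ⟩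
    toℕ t % m                                   ≡⟨ toℕ<m⇒%≡ t ⟩
    toℕ t                                       ∎
    where open ≡-Reasoning

  offset-zero⇒≡ : ∀ {i t} → offset i t ≡ fzero → i ≡ t
  offset-zero⇒≡ {i} {t} e = FP.toℕ-injective (begin
    toℕ i                                  ≡⟨ toℕ<m⇒%≡ i ⟨
    toℕ i % m                              ≡⟨ cong (_% m) (ℕP.+-identityʳ (toℕ i)) ⟨
    (toℕ i ℕ.+ 0) % m                      ≡⟨ cong (λ x → (toℕ i ℕ.+ toℕ x) % m) e ⟨
    (toℕ i ℕ.+ toℕ (offset i t)) % m       ≡⟨ offset-spec i t ⟩
    toℕ t                                  ∎)
    where open ≡-Reasoning

  idM-nonzero : ∀ {x : Fin m} {j} → toℕ x ≡ suc j → idM x fzero ≡ 0ℚ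
  idM-nonzero {fsuc _} _ = refl

  idM-offset : ∀ i t → idM (offset i t) fzero ≡ idM i t
  idM-offset i t with i FP.≟ t
  ... | yes refl = cong (λ x → idM x fzero) (offset-diag i)
  ... | no i≢t = idM-off (i≢t ∘ offset-zero⇒≡)

  SmoothsToDelta : (Fin m → ℚ) → Set
  SmoothsToDelta a = ∀ d → smooth121 (a d) (a (rot d)) (a (rot (rot d))) ≡ idM (rot d) fzero + idM (rot d) fzero

  sum-smooth121-rot : (g : Fin m → ℚ) →
                      sum (λ i → smooth121 (g i) (g (rot i)) (g (rot (rot i)))) ≡ smooth121 (sum g) (sum g) (sum g)
  sum-smooth121-rot g = trans (sum-smooth121 g (g ∘ rot) (g ∘ rot ∘ rot))
    (cong₂ (λ u v → smooth121 (sum g) u v) (sum-rot g) (trans (sum-rot (g ∘ rot)) (sum-rot g)))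

  sum-twice-idM-rot : ∀ t → sum (λ i → idM (rot i) t + idM (rot i) t) ≡ 1ℚ + 1ℚ
  sum-twice-idM-rot t = trans (∑-distrib-+ f f) (cong (λ s → s + s) (trans (sum-rot (λ i → idM i t)) (sum-idMˡ t)))
    where
    f : Fin m → ℚ
    f i = idM (rot i) t

  module _ {a : Fin m → ℚ} (smooth : SmoothsToDelta a) where

    private
      C : Fin m → Fin m → ℚ
      C = circ m a

    circ-smooth-column : ∀ i t → smooth121 (C i t) (C (rot i) t) (C (rot (rot i)) t) ≡ idM (rot i) t + idM (rot i) t
    circ-smooth-column i t = begin
      smooth121 (a (offset i t)) (a (offset (rot i) t)) (a x)  ≡⟨ cong₂ (λ u v → smooth121 (a u) (a v) (a x)) i-step ri-step ⟩
      smooth121 (a (rot (rot x))) (a (rot x)) (a x)            ≡⟨ smooth121-comm (a (rot (rot x))) (a (rot x)) (a x) ⟩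
      smooth121 (a x) (a (rot x)) (a (rot (rot x)))            ≡⟨ smooth x ⟩
      idM (rot x) fzero + idM (rot x) fzero                    ≡⟨ cong (λ u → idM u fzero + idM u fzero) ri-step ⟨
      idM (offset (rot i) t) fzero + idM (offset (rot i) t) fzero ≡⟨ cong (λ u → u + u) (idM-offset (rot i) t) ⟩
      idM (rot i) t + idM (rot i) t                            ∎
      where
      open ≡-Reasoning
      x = offset (rot (rot i)) t
      ri-step : offset (rot i) t ≡ rot x
      ri-step = offset-rotˡ (rot i) t
      i-step : offset i t ≡ rot (rot x)
      i-step = trans (offset-rotˡ i t) (cong rot ri-step)

    circ-smooth-row : ∀ i t → smooth121 (C i t) (C i (rot t)) (C i (rot (rot t))) ≡ idM i (rot t) + idM i (rot t)
    circ-smooth-row i t = begin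
      smooth121 (a x) (a (offset i (rot t))) (a (offset i (rot (rot t))))
        ≡⟨ cong₂ (λ u v → smooth121 (a x) (a u) (a v)) t-step tt-step ⟩
      smooth121 (a x) (a (rot x)) (a (rot (rot x)))            ≡⟨ smooth x ⟩
      idM (rot x) fzero + idM (rot x) fzero                    ≡⟨ cong (λ u → idM u fzero + idM u fzero) t-step ⟨
      idM (offset i (rot t)) fzero + idM (offset i (rot t)) fzero ≡⟨ cong (λ u → u + u) (idM-offset i (rot t)) ⟩
      idM i (rot t) + idM i (rot t)                            ∎
      where
      open ≡-Reasoning
      x = offset i t
      t-step : offset i (rot t) ≡ rot x
      t-step = offset-rotʳ i t
      tt-step : offset i (rot (rot t)) ≡ rot (rot x)
      tt-step = trans (offset-rotʳ i (rot t)) (cong rot t-step)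

    circ-column-sum : ∀ t → sum (λ i → C i t) ≡ ½
    circ-column-sum t = smooth121-const (begin
      smooth121 (sum (λ i → C i t)) (sum (λ i → C i t)) (sum (λ i → C i t)) ≡⟨ sum-smooth121-rot (λ i → C i t) ⟨
      sum (λ i → smooth121 (C i t) (C (rot i) t) (C (rot (rot i)) t))      ≡⟨ sum-cong-≗ (λ i → circ-smooth-column i t) ⟩
      sum (λ i → idM (rot i) t + idM (rot i) t)                           ≡⟨ sum-twice-idM-rot t ⟩
      1ℚ + 1ℚ                                                             ∎)
      where open ≡-Reasoning

    circ-row-sum : ∀ i → sum (C i) ≡ ½
    circ-row-sum i = smooth121-const (begin
      smooth121 (sum (C i)) (sum (C i)) (sum (C i))                       ≡⟨ sum-smooth121-rot (C i) ⟨
      sum (λ t → smooth121 (C i t) (C i (rot t)) (C i (rot (rot t))))      ≡⟨ sum-cong-≗ (circ-smooth-row i) ⟩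
      sum (λ t → idM i (rot t) + idM i (rot t))                           ≡⟨ ∑-distrib-+ (idM i ∘ rot) (idM i ∘ rot) ⟩
      sum (idM i ∘ rot) + sum (idM i ∘ rot)                               ≡⟨ cong (λ s → s + s) (trans (sum-rot (idM i)) (sum-idMʳ i)) ⟩
      1ℚ + 1ℚ                                                             ∎)
      where open ≡-Reasoning

    circ-columns-independent : (x : Fin m → ℚ) → (∀ i → sum (λ t → x t * C i t) ≡ 0ℚ) → ∀ t → x t ≡ 0ℚ
    circ-columns-independent x Cx≡0 t with rot-surjective t
    ... | i , refl = double≡0⇒≡0 (begin
      x (rot i) + x (rot i)                                                 ≡⟨ sum-*-twice-idM x (rot i) ⟨
      sum (λ t → x t * (idM (rot i) t + idM (rot i) t))                     ≡⟨ sum-cong-≗ (λ t → cong (x t *_) (circ-smooth-column i t)) ⟨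
      sum (λ t → x t * smooth121 (C i t) (C (rot i) t) (C (rot (rot i)) t))
        ≡⟨ sum-*-smooth121 x (C i) (λ t → C (rot i) t) (λ t → C (rot (rot i)) t) ⟩
      smooth121 (Cx i) (Cx (rot i)) (Cx (rot (rot i)))
        ≡⟨ cong₂ (λ u v → smooth121 u v (Cx (rot (rot i)))) (Cx≡0 i) (Cx≡0 (rot i)) ⟩
      smooth121 0ℚ 0ℚ (Cx (rot (rot i)))                                    ≡⟨ cong (smooth121 0ℚ 0ℚ) (Cx≡0 (rot (rot i))) ⟩
      0ℚ                                                                    ∎)
      where
      open ≡-Reasoning
      Cx : Fin m → ℚ
      Cx i = sum (λ t → x t * C i t)

-- The special Laplacian of the wheel with n = 2p + 2 vertices

cvec-hit : ∀ {m k} (t : Fin m) → toℕ t ≡ k ⊎ toℕ t ℕ.+ k ≡ m → k ≤ m → cvec m k t ≡ 1ℚ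
cvec-hit {m} {k} t hit k≤m with suc (toℕ t) ℕ.≟ suc k | suc (toℕ t) ℕ.≟ suc m ∸ k
... | yes _ | _     = refl
... | no _  | yes _ = refl
... | no ≢k | no ≢m-k with hit
...   | inj₁ t≡k   = ⊥-elim (≢k (cong suc t≡k))
...   | inj₂ t+k≡m = ⊥-elim (≢m-k (begin
  suc (toℕ t)            ≡⟨ cong suc (ℕP.m+n∸n≡m (toℕ t) k) ⟨
  suc (toℕ t ℕ.+ k ∸ k)  ≡⟨ cong (λ x → suc (x ∸ k)) t+k≡m ⟩
  suc (m ∸ k)            ≡⟨ ℕP.+-∸-assoc 1 k≤m ⟨
  suc m ∸ k              ∎))
  where open ≡-Reasoning

cvec-miss : ∀ {m k} (t : Fin m) → toℕ t ≢ k → toℕ t ℕ.+ k ≢ m → k ≤ m → cvec m k t ≡ 0ℚ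
cvec-miss {m} {k} t t≢k t+k≢m k≤m with suc (toℕ t) ℕ.≟ suc k | suc (toℕ t) ℕ.≟ suc m ∸ k
... | yes t≡k | _      = ⊥-elim (t≢k (ℕP.suc-injective t≡k))
... | no _    | yes t≡m-k = ⊥-elim (t+k≢m (begin
  toℕ t ℕ.+ k    ≡⟨ cong (ℕ._+ k) (ℕP.suc-injective (trans t≡m-k (ℕP.+-∸-assoc 1 k≤m))) ⟩
  m ∸ k ℕ.+ k    ≡⟨ ℕP.m∸n+n≡m k≤m ⟩
  m              ∎))
  where open ≡-Reasoning
... | no _    | no _   = refl

module Wheel (p : ℕ) where

  open Circulant (p ℕ.+ p)

  n : ℕ
  n = suc m

  L : Matrix n
  L = specialLaplacian n

  summand : ℕ → Matrix n
  summand k = weight m k · lowerRight (circ m (cvec m k))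

  summands : Fin n → Fin n → ℚ
  summands a b = listSum (applyUpTo (λ j → summand (suc j) a b) p)

  L-entry : ∀ a b → L a b ≡ (+ m / 2) * idM a b + (- ½) * hubM a b + summands a b
  L-entry a b = cong (λ x → (+ m / 2) * idM a b + (- ½) * hubM a b + x) (begin
    sumM (map summand (map suc (upTo (n ℕ./ 2 ∸ 1)))) a b
      ≡⟨ cong (λ q → sumM (map summand (map suc (upTo q))) a b) n/2∸1≡p ⟩
    sumM (map summand (map suc (upTo p))) a b
      ≡⟨ sumM-entry (map summand (map suc (upTo p))) a b ⟩
    listSum (map (λ M → M a b) (map summand (map suc (upTo p))))
      ≡⟨ cong listSum (trans (cong (map _) (trans (cong (map summand) (LP.map-upTo suc p)) (LP.map-applyUpTo suc summand p)))
                              (LP.map-applyUpTo (summand ∘ suc) (λ M → M a b) p)) ⟩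
    summands a b ∎)
    where
    open ≡-Reasoning
    n/2∸1≡p : n ℕ./ 2 ∸ 1 ≡ p
    n/2∸1≡p = trans (cong (λ x → x ℕ./ 2 ∸ 1) (n≡[1+p]*2 p)) (cong (_∸ 1) (m*n/n≡m (suc p) 2))
      where
      n≡[1+p]*2 : ∀ p → suc (suc (p ℕ.+ p)) ≡ suc p ℕ.* 2
      n≡[1+p]*2 = ℕ-Solver.solve-∀

  summands-vanish : ∀ a b → (∀ {A : Matrix m} → lowerRight A a b ≡ 0ℚ) → summands a b ≡ 0ℚ
  summands-vanish a b A≡0 = listSum-applyUpTo-zero p _ (λ j _ → trans (cong (weight m (suc j) *_) A≡0) (ℚP.*-zeroʳ (weight m (suc j))))

  L-hub-hub : L fzero fzero ≡ + m / 2
  L-hub-hub = begin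
    L fzero fzero                                           ≡⟨ L-entry fzero fzero ⟩
    (+ m / 2) * 1ℚ + 0ℚ + summands fzero fzero              ≡⟨ cong (λ s → (+ m / 2) * 1ℚ + 0ℚ + s) (summands-vanish fzero fzero refl) ⟩
    (+ m / 2) * 1ℚ + 0ℚ + 0ℚ
      ≡⟨ trans (ℚP.+-identityʳ _) (trans (ℚP.+-identityʳ _) (ℚP.*-identityʳ (+ m / 2))) ⟩
    + m / 2                                                 ∎
    where open ≡-Reasoning

  hub-rim-entry : ∀ {a b} → idM a b ≡ 0ℚ → hubM a b ≡ 1ℚ → summands a b ≡ 0ℚ → L a b ≡ - ½
  hub-rim-entry {a} {b} idM≡0 hubM≡1 summands≡0 = begin
    L a b                                                   ≡⟨ L-entry a b ⟩
    (+ m / 2) * idM a b + (- ½) * hubM a b + summands a b   ≡⟨ cong₂ (λ x y → (+ m / 2) * x + (- ½) * y + summands a b) idM≡0 hubM≡1 ⟩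
    (+ m / 2) * 0ℚ + (- ½) + summands a b                   ≡⟨ cong₂ (λ x y → x + (- ½) + y) (ℚP.*-zeroʳ (+ m / 2)) summands≡0 ⟩
    0ℚ + (- ½) + 0ℚ                                         ≡⟨⟩
    - ½                                                     ∎
    where open ≡-Reasoning

  L-hub-rim : ∀ j → L fzero (fsuc j) ≡ - ½
  L-hub-rim j = hub-rim-entry refl refl (summands-vanish fzero (fsuc j) refl)

  L-rim-hub : ∀ i → L (fsuc i) fzero ≡ - ½
  L-rim-hub i = hub-rim-entry refl refl (summands-vanish (fsuc i) fzero refl)

  rimRow : Fin m → ℚ
  rimRow d = weight m (toℕ d)

  rimSum : Fin m → ℚ
  rimSum d = listSum (applyUpTo (λ j → weight m (suc j) * cvec m (suc j) d) p)

  private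
    p≤m : p ≤ m
    p≤m = ℕP.≤-trans (ℕP.m≤m+n p p) (ℕP.n≤1+n _)

    j<p⇒1+j≤m : ∀ {j} → j < p → suc j ≤ m
    j<p⇒1+j≤m j<p = ℕP.≤-trans j<p p≤m

    weighted-miss : ∀ {j} (d : Fin m) → toℕ d ≢ suc j → toℕ d ℕ.+ suc j ≢ m → j < p →
                    weight m (suc j) * cvec m (suc j) d ≡ 0ℚ
    weighted-miss {j} d d≢1+j d+1+j≢m j<p =
      trans (cong (weight m (suc j) *_) (cvec-miss d d≢1+j d+1+j≢m (j<p⇒1+j≤m j<p))) (ℚP.*-zeroʳ (weight m (suc j)))

    weighted-hit : ∀ {j} (d : Fin m) → toℕ d ≡ suc j ⊎ toℕ d ℕ.+ suc j ≡ m → j < p →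
                   weight m (suc j) * cvec m (suc j) d ≡ weight m (suc j)
    weighted-hit {j} d hit j<p =
      trans (cong (weight m (suc j) *_) (cvec-hit d hit (j<p⇒1+j≤m j<p))) (ℚP.*-identityʳ (weight m (suc j)))

  rimSum-zero : rimSum fzero ≡ 0ℚ
  rimSum-zero = listSum-applyUpTo-zero p _ λ j j<p →
    weighted-miss fzero (λ ()) (ℕP.<⇒≢ (s≤s (ℕP.≤-trans j<p (ℕP.m≤m+n p p)))) j<p

  rimSum-low : ∀ d {j₀} → toℕ d ≡ suc j₀ → j₀ < p → rimSum d ≡ rimRow d
  rimSum-low d {j₀} d≡1+j₀ j₀<p = begin
    rimSum d                                   ≡⟨ listSum-applyUpTo-single _ j₀<p miss ⟩
    weight m (suc j₀) * cvec m (suc j₀) d      ≡⟨ weighted-hit d (inj₁ d≡1+j₀) j₀<p ⟩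
    weight m (suc j₀)                          ≡⟨ cong (weight m) d≡1+j₀ ⟨
    rimRow d                                   ∎
    where
    open ≡-Reasoning
    miss : ∀ j → j < p → j ≢ j₀ → weight m (suc j) * cvec m (suc j) d ≡ 0ℚ
    miss j j<p j≢j₀ = weighted-miss d d≢1+j d+1+j≢m j<p
      where
      d≢1+j : toℕ d ≢ suc j
      d≢1+j e = j≢j₀ (ℕP.suc-injective (trans (sym e) d≡1+j₀))
      d+1+j≢m : toℕ d ℕ.+ suc j ≢ m
      d+1+j≢m = ℕP.<⇒≢ (s≤s (subst (_≤ p ℕ.+ p) (cong (ℕ._+ suc j) (sym d≡1+j₀)) (ℕP.+-mono-≤ j₀<p j<p)))

  rimSum-high : ∀ d → p < toℕ d → rimSum d ≡ rimRow d
  rimSum-high d p<d = begin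
    rimSum d                                   ≡⟨ listSum-applyUpTo-single _ j₀<p miss ⟩
    weight m (suc j₀) * cvec m (suc j₀) d      ≡⟨ weighted-hit d (inj₂ d+1+j₀≡m) j₀<p ⟩
    weight m (suc j₀)                          ≡⟨ weight-complement p {toℕ d} d+1+j₀≡m ⟩
    rimRow d                                   ∎
    where
    open ≡-Reasoning
    d≤2p : toℕ d ≤ p ℕ.+ p
    d≤2p = ℕP.≤-pred (FP.toℕ<n d)
    j₀ = p ℕ.+ p ∸ toℕ d
    1+j₀≡m∸d : suc j₀ ≡ m ∸ toℕ d
    1+j₀≡m∸d = sym (ℕP.+-∸-assoc 1 d≤2p)
    d+1+j₀≡m : toℕ d ℕ.+ suc j₀ ≡ m
    d+1+j₀≡m = trans (cong (toℕ d ℕ.+_) 1+j₀≡m∸d) (ℕP.m+[n∸m]≡n (ℕP.<⇒≤ (FP.toℕ<n d)))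
    j₀<p : j₀ < p
    j₀<p = subst (j₀ <_) (ℕP.m+n∸m≡n p p) (ℕP.∸-monoʳ-< p<d d≤2p)
    miss : ∀ j → j < p → j ≢ j₀ → weight m (suc j) * cvec m (suc j) d ≡ 0ℚ
    miss j j<p j≢j₀ = weighted-miss d d≢1+j d+1+j≢m j<p
      where
      d≢1+j : toℕ d ≢ suc j
      d≢1+j e = ℕP.<-irrefl (sym e) (ℕP.≤-<-trans j<p p<d)
      d+1+j≢m : toℕ d ℕ.+ suc j ≢ m
      d+1+j≢m e = j≢j₀ (ℕP.suc-injective (ℕP.+-cancelˡ-≡ (toℕ d) _ _ (trans e (sym d+1+j₀≡m))))

  diagonal+rimSum : ∀ d → (+ m / 2) * idM d fzero + rimSum d ≡ rimRow d
  diagonal+rimSum fzero = begin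
    (+ m / 2) * 1ℚ + rimSum fzero    ≡⟨ cong₂ _+_ (ℚP.*-identityʳ (+ m / 2)) rimSum-zero ⟩
    + m / 2 + 0ℚ                     ≡⟨ ℚP.+-identityʳ (+ m / 2) ⟩
    + m / 2                          ≡⟨ weight-zero m ⟨
    rimRow fzero                     ∎
    where open ≡-Reasoning
  diagonal+rimSum (fsuc e) = begin
    (+ m / 2) * 0ℚ + rimSum (fsuc e) ≡⟨ cong (λ x → x + rimSum (fsuc e)) (ℚP.*-zeroʳ (+ m / 2)) ⟩
    0ℚ + rimSum (fsuc e)             ≡⟨ ℚP.+-identityˡ (rimSum (fsuc e)) ⟩
    rimSum (fsuc e)                  ≡⟨ low-or-high (suc (toℕ e) ℕP.≤? p) ⟩
    rimRow (fsuc e)                  ∎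
    where
    open ≡-Reasoning
    low-or-high : Dec (suc (toℕ e) ≤ p) → rimSum (fsuc e) ≡ rimRow (fsuc e)
    low-or-high (yes 1+e≤p) = rimSum-low (fsuc e) refl 1+e≤p
    low-or-high (no 1+e≰p)  = rimSum-high (fsuc e) (ℕP.≰⇒> 1+e≰p)

  L-rim-rim : ∀ i t → L (fsuc i) (fsuc t) ≡ circ m rimRow i t
  L-rim-rim i t = begin
    L (fsuc i) (fsuc t)                                       ≡⟨ L-entry (fsuc i) (fsuc t) ⟩
    (+ m / 2) * idM (fsuc i) (fsuc t) + 0ℚ + rimSum d
      ≡⟨ cong (λ x → x + rimSum d) (ℚP.+-identityʳ ((+ m / 2) * idM (fsuc i) (fsuc t))) ⟩
    (+ m / 2) * idM (fsuc i) (fsuc t) + rimSum d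
      ≡⟨ cong (λ x → (+ m / 2) * x + rimSum d) (trans (idM-suc i t) (sym (idM-offset i t))) ⟩
    (+ m / 2) * idM d fzero + rimSum d                        ≡⟨ diagonal+rimSum d ⟩
    rimRow d                                                  ∎
    where
    open ≡-Reasoning
    d = offset i t

  1≤p⇒2≤m : 1 ≤ p → 2 ≤ m
  1≤p⇒2≤m 1≤p = s≤s (ℕP.≤-trans 1≤p (ℕP.m≤m+n p p))

  rimRow-smooths : 1 ≤ p → SmoothsToDelta rimRow
  rimRow-smooths 1≤p d with ℕP.m≤n⇒m<n∨m≡n (FP.toℕ<n d)
  ... | inj₁ 1+d<m with ℕP.m≤n⇒m<n∨m≡n 1+d<m
  ...   | inj₁ 2+d<m = begin
    smooth121 (w r) (rimRow (rot d)) (rimRow (rot (rot d)))   ≡⟨ cong₂ (λ u v → smooth121 (w r) (w u) (w v)) rot-d rot²-d ⟩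
    smooth121 (w r) (w (suc r)) (w (suc (suc r)))             ≡⟨ weight-recurrence m r ⟩
    0ℚ + 0ℚ                                                   ≡⟨ cong (λ x → x + x) (idM-nonzero rot-d) ⟨
    idM (rot d) fzero + idM (rot d) fzero                     ∎
    where
    open ≡-Reasoning
    w = weight m
    r = toℕ d
    rot-d = toℕ-rot-< d 1+d<m
    rot²-d = trans (toℕ-rot-< (rot d) (subst (λ x → suc x < m) (sym rot-d) 2+d<m)) (cong suc rot-d)
  ...   | inj₂ 2+d≡m = begin
    smooth121 (w r) (rimRow (rot d)) (rimRow (rot (rot d)))   ≡⟨ cong₂ (λ u v → smooth121 (w r) (w u) (w v)) rot-d rot²-d ⟩
    smooth121 (w r) (w (suc r)) (w 0)
      ≡⟨ cong₂ (λ u v → smooth121 u v (w 0)) (weight-complement p {2} 2+d≡m) (weight-complement p {1} 2+d≡m) ⟩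
    smooth121 (w 2) (w 1) (w 0)                               ≡⟨ smooth121-comm (w 2) (w 1) (w 0) ⟩
    smooth121 (w 0) (w 1) (w 2)                               ≡⟨ weight-recurrence m 0 ⟩
    0ℚ + 0ℚ                                                   ≡⟨ cong (λ x → x + x) (idM-nonzero rot-d) ⟨
    idM (rot d) fzero + idM (rot d) fzero                     ∎
    where
    open ≡-Reasoning
    w = weight m
    r = toℕ d
    rot-d = toℕ-rot-< d 1+d<m
    rot²-d = toℕ-rot-≡ (rot d) (trans (cong suc rot-d) 2+d≡m)
  rimRow-smooths 1≤p d | inj₂ 1+d≡m = begin
    smooth121 (w r) (rimRow (rot d)) (rimRow (rot (rot d)))   ≡⟨ cong₂ (λ u v → smooth121 (w r) (w u) (w v)) rot-d rot²-d ⟩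
    smooth121 (w r) (w 0) (w 1)                               ≡⟨ cong (λ u → smooth121 u (w 0) (w 1)) (weight-complement p {1} 1+d≡m) ⟩
    smooth121 (w 1) (w 0) (w 1)                               ≡⟨ weight-wrap m ⟩
    1ℚ + 1ℚ                                                   ≡⟨ cong (λ x → idM x fzero + idM x fzero) (FP.toℕ-injective rot-d) ⟨
    idM (rot d) fzero + idM (rot d) fzero                     ∎
    where
    open ≡-Reasoning
    w = weight m
    r = toℕ d
    rot-d = toℕ-rot-≡ d 1+d≡m
    rot²-d = trans (toℕ-rot-< (rot d) (subst (λ x → suc x < m) (sym rot-d) (1≤p⇒2≤m 1≤p))) (cong suc rot-d)

  hub+rim≡0 : + m / 2 + sum {m} (λ _ → - ½) ≡ 0ℚ
  hub+rim≡0 = trans (cong (λ x → + m / 2 + x) (sum-neg-½ m)) (ℚP.+-inverseʳ (+ m / 2))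

  L-column-sums : 1 ≤ p → ∀ j → colSum L j ≡ 0ℚ
  L-column-sums _ fzero = begin
    L fzero fzero + sumFin (λ i → L (fsuc i) fzero)
      ≡⟨ cong₂ _+_ L-hub-hub (trans (sumFin≡sum (λ i → L (fsuc i) fzero)) (sum-cong-≗ L-rim-hub)) ⟩
    + m / 2 + sum {m} (λ _ → - ½)                    ≡⟨ hub+rim≡0 ⟩
    0ℚ                                               ∎
    where open ≡-Reasoning
  L-column-sums 1≤p (fsuc j) = begin
    L fzero (fsuc j) + sumFin (λ i → L (fsuc i) (fsuc j))
      ≡⟨ cong₂ _+_ (L-hub-rim j) (trans (sumFin≡sum (λ i → L (fsuc i) (fsuc j))) (sum-cong-≗ (λ i → L-rim-rim i j))) ⟩
    - ½ + sum (λ i → circ m rimRow i j)   ≡⟨ cong (λ x → - ½ + x) (circ-column-sum {a = rimRow} (rimRow-smooths 1≤p) j) ⟩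
    - ½ + ½                              ≡⟨⟩
    0ℚ                                   ∎
    where open ≡-Reasoning

  L-row-sums : 1 ≤ p → ∀ i → sum (L i) ≡ 0ℚ
  L-row-sums _ fzero = begin
    L fzero fzero + sum (λ t → L fzero (fsuc t))  ≡⟨ cong₂ _+_ L-hub-hub (sum-cong-≗ L-hub-rim) ⟩
    + m / 2 + sum {m} (λ _ → - ½)                 ≡⟨ hub+rim≡0 ⟩
    0ℚ                                            ∎
    where open ≡-Reasoning
  L-row-sums 1≤p (fsuc i) = begin
    L (fsuc i) fzero + sum (λ t → L (fsuc i) (fsuc t))  ≡⟨ cong₂ _+_ (L-rim-hub i) (sum-cong-≗ (L-rim-rim i)) ⟩
    - ½ + sum (circ m rimRow i)                         ≡⟨ cong (λ x → - ½ + x) (circ-row-sum {a = rimRow} (rimRow-smooths 1≤p) i) ⟩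
    - ½ + ½                                             ≡⟨⟩
    0ℚ                                                  ∎
    where open ≡-Reasoning

  L-rim-columns-independent : 1 ≤ p → LinIndepCols L fsuc
  L-rim-columns-independent 1≤p x Lx≡0 = circ-columns-independent {a = rimRow} (rimRow-smooths 1≤p) x λ i → begin
    sum (λ t → x t * circ m rimRow i t)       ≡⟨ sum-cong-≗ (λ t → cong (x t *_) (L-rim-rim i t)) ⟨
    sum (λ t → x t * L (fsuc i) (fsuc t))     ≡⟨ sumFin≡sum (λ t → x t * L (fsuc i) (fsuc t)) ⟨
    sumFin (λ t → x t * L (fsuc i) (fsuc t))  ≡⟨ Lx≡0 (fsuc i) ⟩
    0ℚ                                        ∎
    where open ≡-Reasoning

even≥4⇒2p+2 : ∀ {n} → 4 ≤ n → 2 ∣ n → ∃ λ p → 1 ≤ p × n ≡ suc (suc (p ℕ.+ p))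
even≥4⇒2p+2 4≤n (divides q refl) = half q 4≤n
  where
  half : ∀ q → 4 ≤ q ℕ.* 2 → ∃ λ p → 1 ≤ p × q ℕ.* 2 ≡ suc (suc (p ℕ.+ p))
  half (suc (suc p)) _ = suc p , s≤s z≤n , lemma p
    where
    lemma : ∀ p → suc (suc p) ℕ.* 2 ≡ suc (suc (suc p ℕ.+ suc p))
    lemma = ℕ-Solver.solve-∀
  half (suc zero) (s≤s (s≤s ()))

theorem2 : (n : ℕ) → 4 ≤ n → 2 ∣ n →
    ((j : Fin n) → colSum (specialLaplacian n) j ≡ 0ℚ)
      × HasRank (specialLaplacian n) (n ∸ 1)
theorem2 n 4≤n 2∣n with even≥4⇒2p+2 4≤n 2∣n
... | p , 1≤p , refl =
  L-column-sums 1≤p ,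
  (fsuc , FP.suc-injective , L-rim-columns-independent 1≤p) ,
  zero-row-sums⇒¬LinIndepCols L (L-row-sums 1≤p)
  where open Wheel p
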